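{- Let $m\geq3$. When $q=1$, every rational number $r$ with $0<r\leq1$ appears at least once as a vertex label in the $(q,m-1)$-Calkin-Wilf tree of order $m$.
   Context: For $m\ge3$, the $(q,m-1)$-Calkin-Wilf tree of order $m$ is the infinite complete $m$-ary rooted tree (ordered children: first, ..., $m$-th) with vertices labeled by rational functions of $q$ (here evaluated at $q=1$), defined recursively: the root is labeled $\frac11$; for a vertex $v$ with label $\lambda(v)=\frac ab$, each of its first $m-2$ children is labeled $\frac1{1+q}$, its $(m-1)$-st child is labeled $\frac{b}{b+qa}$, and its $m$-th child is labeled $\frac{1}{1+qp\prod_{j=1}^{s}1/\lambda(v_j)}$, where $v_1=v$, $s\ge1$ is maximal such that there are vertices $v_2,\dots,v_s$ with $v_j$ the $(m-1)$-st child of $v_{j+1}$ for $j<s$, and $p=\lambda(v_{s+1})$ if $v_s$ is the $(m-2)$-nd child of a vertex $v_{s+1}$, $p=1$ otherwise. -}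

module Defs where

open import Data.Nat using (ℕ; zero; suc; _+_; _*_; _∸_)
open import Data.Nat.Properties using (_≟_)
open import Data.Fin using (Fin; toℕ)
open import Data.List using (List; []; _∷_)
open import Data.Product using (_×_; _,_; proj₁; proj₂)
open import Data.Bool using (if_then_else_)
open import Relation.Nullary.Decidable using (⌊_⌋)
open import Data.Integer using (+_)
open import Data.Rational using (ℚ; _/_; 0ℚ)

-- A vertex of the complete m-ary tree is the path from the root,
-- stored in REVERSE: the head is the index of the vertex among the
-- children of its parent (0-based: index i means the (i+1)-st child),
-- the tail is its parent.  [] is the root.
Vertex : ℕ → Set
Vertex m = List (Fin m)

-- A label a/b (evaluated at q = 1) is stored as an unreduced pair (a , b).
Frac : Set
Frac = ℕ × ℕ

-- Data needed for the m-th child of v: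
-- (A , B , p) with A = ∏_{j=1}^s a_j, B = ∏_{j=1}^s b_j where λ(v_j) = a_j/b_j,
-- and p the factor from the definition.
mutual
  label : (m : ℕ) → Vertex m → Frac
  label m [] = (1 , 1)
  label m (c ∷ v) =
    if ⌊ toℕ c ≟ m ∸ 1 ⌋ then mthChild (chain m v)
    else if ⌊ toℕ c ≟ m ∸ 2 ⌋ then secondLast (label m v)
    else (1 , 2)

  chain : (m : ℕ) → Vertex m → ℕ × ℕ × Frac
  chain m [] = (1 , 1 , (1 , 1))              -- root: s = 1, no parent, p = 1
  chain m (d ∷ w) =
    if ⌊ toℕ d ≟ m ∸ 2 ⌋
      then extend (label m (d ∷ w)) (chain m w)   -- v is the (m-1)-st child: continue
      else stop (label m (d ∷ w))
                (if ⌊ toℕ d ≟ m ∸ 3 ⌋ then label m w else (1 , 1))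

  -- (m-1)-st child: a/b ↦ b/(b + q a) at q = 1
  secondLast : Frac → Frac
  secondLast (a , b) = (b , b + a)

  -- m-th child: 1 / (1 + p ∏ 1/λ(v_j)) = pd A / (pd A + pn B)
  mthChild : ℕ × ℕ × Frac → Frac
  mthChild (A , B , (pn , pd)) = (pd * A , pd * A + pn * B)

  extend : Frac → ℕ × ℕ × Frac → ℕ × ℕ × Frac
  extend (a , b) (A , B , p) = (a * A , b * B , p)

  stop : Frac → Frac → ℕ × ℕ × Frac
  stop (a , b) p = (a , b , p)

-- value of a pair as a rational number (denominators are never 0 in the tree)
value : Frac → ℚ
value (a , zero) = 0ℚ
value (a , suc d) = (+ a) / suc d

labelℚ : (m : ℕ) → Vertex m → ℚ
labelℚ m v = value (label m v)

-- Call a vertex plain if it is the root or an m-th (last) child: its m-th child then sees the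
-- chain s = 1, p = 1 and is labelled x/(1+x) when the vertex is labelled x.  The m-th
-- child of the (m-2)-nd (third-last) child of any vertex labelled x is plain and labelled 1/(1+2x).
-- So the plain labels contain 1 and are closed under x ↦ x/(1+x) and x ↦ 1/(1+2x),
-- and every a/b ∈ (0,1] is reached from 1 by these maps, by strong induction on a + b:
-- if 2a ≤ b undo x/(1+x), landing on a/(b-a); if a < b < 2a undo 1/(1+2x) and then
-- x/(1+x), landing on (b-a)/(3a-b).
module Submission where

open import Defs
open import Data.Nat using (ℕ; _≤_)
open import Data.Product using (∃)
open import Relation.Binary.PropositionalEquality using (_≡_)
open import Data.Rational using (ℚ; 0ℚ; 1ℚ) renaming (_<_ to _<ℚ_; _≤_ to _≤ℚ_)

open import Data.Nat using (zero; suc; _+_; _*_; _<_; z≤n; s≤s; _≤?_)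
open import Data.Nat.Properties
  using (_≟_; ≤-trans; <⇒≤; ≰⇒>; m≤n+m; m≤m+n; m<n+m; m<m+n; n≮0; 1+n≢n; m≢1+n+m;
         *-comm; *-identityˡ; *-identityʳ; *-distribˡ-+; +-cancelʳ-≡; m≤n⇒∃[o]m+o≡n)
open import Data.Nat.Induction using (<-wellFounded)
open import Data.Nat.Tactic.RingSolver using (solve-∀)
open import Data.Nat.Coprimality using (Coprime)
open import Data.Fin using (Fin; toℕ; fromℕ; fromℕ<)
open import Data.Fin.Properties using (toℕ-fromℕ; toℕ-fromℕ<)
open import Data.List using ([]; _∷_)
open import Data.Product using (_×_; _,_)
open import Data.Bool using (if_then_else_)
open import Data.Empty using (⊥-elim)
import Data.Integer as ℤ
import Data.Integer.Properties as ℤ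
open import Data.Rational using (mkℚ; *<*; *≤*)
import Data.Rational.Properties as ℚ
open import Data.Rational.Unnormalised using (mkℚᵘ; *≡*)
open import Function using (_∘_)
open import Induction.WellFounded using (Acc; acc)
open import Relation.Nullary using (yes; no)
open import Relation.Nullary.Decidable using (⌊_⌋)
open import Relation.Binary.PropositionalEquality
  using (_≢_; ≢-sym; refl; sym; trans; cong; cong₂; subst; subst₂; module ≡-Reasoning)

infix 4 _≃_

_≃_ : Frac → Frac → Set
(a , b) ≃ (c , d) = a * d ≡ c * b

data Generated : Frac → Set where
  one      : Generated (1 , 1)
  x/[1+x]  : ∀ {a b} → Generated (a , b) → Generated (a , a + b)
  1/[1+2x] : ∀ {a b} → Generated (a , b) → Generated (b , b + 2 * a)

generated-denominator>0 : ∀ {a b} → Generated (a , b) → 0 < b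
generated-denominator>0 one              = s≤s z≤n
generated-denominator>0 (x/[1+x] {a} g)  = ≤-trans (generated-denominator>0 g) (m≤n+m _ a)
generated-denominator>0 (1/[1+2x] {a} g) = ≤-trans (generated-denominator>0 g) (m≤m+n _ (2 * a))

x/[1+x]-≃ : ∀ {c d a b} → (c , d) ≃ (a , b) → (c , c + d) ≃ (a , a + b)
x/[1+x]-≃ {c} {d} {a} {b} cb≡ad = begin
  c * (a + b)     ≡⟨ *-distribˡ-+ c a b ⟩
  c * a + c * b   ≡⟨ cong₂ _+_ (*-comm c a) cb≡ad ⟩
  a * c + a * d   ≡⟨ *-distribˡ-+ a c d ⟨
  a * (c + d)     ∎
  where open ≡-Reasoning

1/[1+2x]∘x/[1+x]-≃ : ∀ {c d} e t → (c , d) ≃ (e , e + (t + t)) →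
  (c + d , (c + d) + 2 * c) ≃ (e + t , (e + t) + e)
1/[1+2x]∘x/[1+x]-≃ {c} {d} e t c[e+2t]≡ed = +-cancelʳ-≡ (e * d) _ _ (begin
  (c + d) * ((e + t) + e) + e * d            ≡⟨ cong ((c + d) * ((e + t) + e) +_) c[e+2t]≡ed ⟨
  (c + d) * ((e + t) + e) + c * (e + (t + t)) ≡⟨ rearrange c d e t ⟩
  (e + t) * ((c + d) + 2 * c) + e * d        ∎)
  where
  open ≡-Reasoning
  rearrange : ∀ c d e t →
    (c + d) * ((e + t) + e) + c * (e + (t + t)) ≡ (e + t) * ((c + d) + 2 * c) + e * d
  rearrange = solve-∀

Reachable : ℕ → ℕ → Set
Reachable a b = ∃ λ x → Generated x × x ≃ (a , b)

reachable : ∀ {a b} → 0 < a → a ≤ b → Reachable a b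
reachable 0<a a≤b with e , refl ← m≤n⇒∃[o]m+o≡n a≤b = go _ e 0<a (<-wellFounded _)
  where
  smaller : ∀ e t → suc e + (suc e + (t + t)) < (suc e + t) + ((suc e + t) + suc e)
  smaller e t = subst (suc e + (suc e + (t + t)) <_) (shuffle e t) (m<m+n _ (s≤s z≤n))
    where
    shuffle : ∀ e t → suc e + (suc e + (t + t)) + suc e ≡ (suc e + t) + ((suc e + t) + suc e)
    shuffle = solve-∀

  1≃a/[a+0] : ∀ a → 1 * (a + 0) ≡ a * 1
  1≃a/[a+0] = solve-∀

  go : ∀ a e → 0 < a → Acc _<_ (a + (a + e)) → Reachable a (a + e)
  go a e 0<a (acc rec) with a ≤? e
  ... | yes a≤e with f , refl ← m≤n⇒∃[o]m+o≡n a≤e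
    with (c , d) , g , x≃ ← go a f 0<a (rec (m<n+m _ 0<a))
    = (c , c + d) , x/[1+x] g , x/[1+x]-≃ {c} {d} {a} x≃
  go a zero _ _ | no _ = (1 , 1) , one , 1≃a/[a+0] a
  go a (suc e) _ (acc rec) | no a≰1+e with t , refl ← m≤n⇒∃[o]m+o≡n (<⇒≤ (≰⇒> a≰1+e))
    with (c , d) , g , x≃ ← go (suc e) (t + t) (s≤s z≤n) (rec (smaller e t))
    = (c + d , (c + d) + 2 * c) , 1/[1+2x] (x/[1+x] g) , 1/[1+2x]∘x/[1+x]-≃ {c} {d} (suc e) t x≃

if-≟-yes : ∀ {A : Set} {m n} {x y : A} → m ≡ n → (if ⌊ m ≟ n ⌋ then x else y) ≡ x
if-≟-yes {m = m} {n} m≡n with m ≟ n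
... | yes _  = refl
... | no m≢n = ⊥-elim (m≢n m≡n)

if-≟-no : ∀ {A : Set} {m n} {x y : A} → m ≢ n → (if ⌊ m ≟ n ⌋ then x else y) ≡ y
if-≟-no {m = m} {n} m≢n with m ≟ n
... | yes m≡n = ⊥-elim (m≢n m≡n)
... | no _    = refl

module Tree (k : ℕ) where

  lastChild : Fin (3 + k)
  lastChild = fromℕ (2 + k)

  thirdLastChild : Fin (3 + k)
  thirdLastChild = fromℕ< (m<n+m k (s≤s z≤n))

  private
    toℕ-lastChild : toℕ lastChild ≡ 2 + k
    toℕ-lastChild = toℕ-fromℕ (2 + k)

    toℕ-thirdLastChild : toℕ thirdLastChild ≡ k
    toℕ-thirdLastChild = toℕ-fromℕ< (m<n+m k (s≤s z≤n))

  Plain : Vertex (3 + k) → Set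
  Plain v = chain (3 + k) v ≡ stop (label (3 + k) v) (1 , 1)

  label-lastChild : ∀ v → label (3 + k) (lastChild ∷ v) ≡ mthChild (chain (3 + k) v)
  label-lastChild v = if-≟-yes toℕ-lastChild

  plain-lastChild : ∀ v → Plain (lastChild ∷ v)
  plain-lastChild v = trans
    (if-≟-no (1+n≢n ∘ trans (sym toℕ-lastChild)))
    (cong (stop _) (if-≟-no (≢-sym (m≢1+n+m k) ∘ trans (sym toℕ-lastChild))))

  label-thirdLastChild : ∀ v → label (3 + k) (thirdLastChild ∷ v) ≡ (1 , 2)
  label-thirdLastChild v = trans
    (if-≟-no (m≢1+n+m k ∘ trans (sym toℕ-thirdLastChild)))
    (if-≟-no (m≢1+n+m k ∘ trans (sym toℕ-thirdLastChild)))

  chain-thirdLastChild : ∀ v →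
    chain (3 + k) (thirdLastChild ∷ v) ≡ stop (1 , 2) (label (3 + k) v)
  chain-thirdLastChild v = trans
    (if-≟-no (m≢1+n+m k ∘ trans (sym toℕ-thirdLastChild)))
    (cong₂ stop (label-thirdLastChild v) (if-≟-yes toℕ-thirdLastChild))

  label-x/[1+x] : ∀ v {a b} → Plain v → label (3 + k) v ≡ (a , b) →
    label (3 + k) (lastChild ∷ v) ≡ (a , a + b)
  label-x/[1+x] v {a} {b} plain label≡ = begin
    label (3 + k) (lastChild ∷ v)   ≡⟨ label-lastChild v ⟩
    mthChild (chain (3 + k) v)       ≡⟨ cong mthChild (trans plain (cong (λ x → stop x (1 , 1)) label≡)) ⟩
    (1 * a , 1 * a + 1 * b)          ≡⟨ cong₂ (λ a b → (a , a + b)) (*-identityˡ a) (*-identityˡ b) ⟩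
    (a , a + b)                      ∎
    where open ≡-Reasoning

  label-1/[1+2x] : ∀ w {a b} → label (3 + k) w ≡ (a , b) →
    label (3 + k) (lastChild ∷ thirdLastChild ∷ w) ≡ (b , b + 2 * a)
  label-1/[1+2x] w {a} {b} label≡ = begin
    label (3 + k) (lastChild ∷ thirdLastChild ∷ w)   ≡⟨ label-lastChild (thirdLastChild ∷ w) ⟩
    mthChild (chain (3 + k) (thirdLastChild ∷ w))    ≡⟨ cong mthChild (trans (chain-thirdLastChild w) (cong (stop (1 , 2)) label≡)) ⟩
    (b * 1 , b * 1 + a * 2)                          ≡⟨ cong₂ (λ b a → (b , b + a)) (*-identityʳ b) (*-comm a 2) ⟩
    (b , b + 2 * a)                                  ∎
    where open ≡-Reasoning

  generated⇒label : ∀ {x} → Generated x → ∃ λ v → Plain v × label (3 + k) v ≡ x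
  generated⇒label one = [] , refl , refl
  generated⇒label (x/[1+x] g) with v , plain , label≡ ← generated⇒label g =
    lastChild ∷ v , plain-lastChild v , label-x/[1+x] v plain label≡
  generated⇒label (1/[1+2x] g) with w , _ , label≡ ← generated⇒label g =
    lastChild ∷ thirdLastChild ∷ w , plain-lastChild (thirdLastChild ∷ w) , label-1/[1+2x] w label≡

value-≃-mkℚ : ∀ {c d n d′} .(cop : Coprime n (suc d′)) → (c , suc d) ≃ (n , suc d′) →
  value (c , suc d) ≡ mkℚ (ℤ.+ n) d′ cop
value-≃-mkℚ {c} {d} {n} {d′} cop c[1+d′]≡n[1+d] = trans
  (ℚ.fromℚᵘ-cong {mkℚᵘ (ℤ.+ c) d} {mkℚᵘ (ℤ.+ n) d′} (*≡* cross))
  (ℚ.fromℚᵘ-toℚᵘ (mkℚ (ℤ.+ n) d′ cop))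
  where
  cross : ℤ.+ c ℤ.* ℤ.+ suc d′ ≡ ℤ.+ n ℤ.* ℤ.+ suc d
  cross = trans (sym (ℤ.pos-* c (suc d′))) (trans (cong ℤ.+_ c[1+d′]≡n[1+d]) (ℤ.pos-* n (suc d)))

unit-interval-generated : ∀ r → 0ℚ <ℚ r → r ≤ℚ 1ℚ → ∃ λ x → Generated x × value x ≡ r
unit-interval-generated (mkℚ (ℤ.+ zero) _ _) (*<* (ℤ.+<+ ())) _
unit-interval-generated (mkℚ ℤ.-[1+ _ ] _ _) (*<* ()) _
unit-interval-generated (mkℚ (ℤ.+ suc a) b cop) _ (*≤* a*1≤1*b)
  with reachable {suc a} {suc b} (s≤s z≤n)
         (ℤ.drop‿+≤+ (subst₂ ℤ._≤_ (ℤ.*-identityʳ _) (ℤ.*-identityˡ _) a*1≤1*b))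
... | (_ , zero) , g , _ = ⊥-elim (n≮0 (generated-denominator>0 g))
... | (c , suc d) , g , x≃r = (c , suc d) , g , value-≃-mkℚ {c} {d} {suc a} {b} cop x≃r

mainTheorem5 : (m : ℕ) → 3 ≤ m → (r : ℚ) → 0ℚ <ℚ r → r ≤ℚ 1ℚ →
    ∃ λ (v : Vertex m) → labelℚ m v ≡ r
mainTheorem5 (suc (suc (suc k))) (s≤s (s≤s (s≤s z≤n))) r 0<r r≤1
  with x , g , value-x≡r ← unit-interval-generated r 0<r r≤1
  with v , _ , label-v≡x ← Tree.generated⇒label k g
  = v , trans (cong value label-v≡x) value-x≡r
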